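{- Let $G$ be a bipartite multigraph with bipartition $(X,Y)$ whose edge set is partitioned into two sets $A,B$ such that $\deg_B(y)\geqslant \deg_A(y)$ for every $y\in Y$, and $\deg_A(x),\deg_B(x)\leqslant \eta$ for every $x\in X$, for some integer $\eta$. Suppose that for some vertex $x_0\in X$ either (i) $\deg_A(x_0)>\deg_B(x_0)$, or (ii) $\deg_A(x_0)=\deg_B(x_0)$ is odd, $\eta$ is even, and $\deg_B(y)$ is even for every $y\in Y$. Then there is a subset $C\subset E(G)$ such that - $\deg_C(y)=\deg_A(y)$ for all $y\in Y$, - $\deg_C(x_0)=\deg_A(x_0)-1$, and - $\deg_A(x)\leqslant \deg_C(x)\leqslant \eta$ for all $x\in X\setminus\{x_0\}$.
   Context: For a set $F$ of edges of a multigraph and a vertex $v$, $\deg_F(v)$ denotes the number of edges of $F$ incident with $v$ (parallel edges counted with multiplicity). -}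

module Defs where

open import Data.Nat using (ℕ; zero; suc; _+_)
open import Data.Fin using (Fin)
open import Data.Bool using (Bool; true; false; _∧_; if_then_else_)
open import Relation.Nullary.Decidable using (⌊_⌋)
open import Data.Fin using (_≟_)

-- Parallel edges are allowed (distinct labels with the same endpoints).
record BipMultigraph (nx ny m : ℕ) : Set where
  field
    xEnd : Fin m → Fin nx
    yEnd : Fin m → Fin ny

EdgeSet : ℕ → Set
EdgeSet m = Fin m → Bool

count : ∀ {m} → (Fin m → Bool) → ℕ
count {zero}  f = 0
count {suc m} f = (if f Fin.zero then 1 else 0) + count (λ i → f (Fin.suc i))
  where import Data.Fin as Fin

degX : ∀ {nx ny m} → BipMultigraph nx ny m → EdgeSet m → Fin nx → ℕ
degX G F x = count (λ e → F e ∧ ⌊ BipMultigraph.xEnd G e ≟ x ⌋)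

degY : ∀ {nx ny m} → BipMultigraph nx ny m → EdgeSet m → Fin ny → ℕ
degY G F y = count (λ e → F e ∧ ⌊ BipMultigraph.yEnd G e ≟ y ⌋)

open import Data.Nat.Divisibility using (_∣_)
open import Relation.Nullary using (¬_)

Even : ℕ → Set
Even n = 2 ∣ n

Odd : ℕ → Set
Odd n = ¬ (2 ∣ n)

-- Grow a set R ⊆ X from {x₀}. For every x ∈ R we keep an edge set C obtained from A by
-- switching along an alternating path from x₀ to x: at each step an A-edge e at the current
-- vertex is traded for a B-edge f with the same Y-end, so every Y-degree is preserved while one
-- unit of X-degree travels from x₀ to the X-end of f. If some x ∈ R∖{x₀} has deg_A(x) < η,
-- the edge set kept for x is the required C. Otherwise R grows until it is closed: every B-edge
-- at an A-neighbour of R has its X-end in R. Counting the edges between R and its A-neighbourhood N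
-- then gives deg_A(R) ≤ deg_A(N) ≤ deg_B(N) ≤ deg_B(R), while deg_B ≤ η = deg_A on R∖{x₀}; hence
-- deg_A(x₀) ≤ deg_B(x₀), contradicting (i). Under (ii) all these inequalities are equalities, so
-- deg_A(R) = deg_B(N) is even, as is deg_A(R∖{x₀}) = η·|R∖{x₀}|, contradicting that deg_A(x₀) is odd.
module Submission where

open import Defs
open import Data.Nat using (ℕ; _≤_; _<_; _>_; _≥_; _∸_; zero; suc; _+_; z≤n; _<?_)
open import Data.Nat.Properties
  using ( ≤-refl; ≤-reflexive; ≤-trans; ≤-antisym; <⇒≱; ≮⇒≥; m≤m+n; m≤n+m
        ; +-comm; +-suc; +-identityʳ; m+n∸n≡m; +-cancelʳ-≡; +-cancelʳ-≤; +-mono-≤; +-monoʳ-≤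
        ; +-commutativeSemigroup; +-0-commutativeMonoid; module ≤-Reasoning)
open import Data.Nat.Divisibility using (∣m∣n⇒∣m+n; ∣m+n∣m⇒∣n; _∣0)
open import Data.Fin using (Fin)
import Data.Fin as Fin
open import Data.Fin.Properties using (_≟_; any?; 0≢1+n; suc-injective)
open import Data.Bool using (Bool; true; false; not; _∧_; _∨_; if_then_else_)
import Data.Bool.Properties as Bool
open import Data.Bool.Properties
  using (∧-identityʳ; ∧-zeroʳ; ∨-identityʳ; ∧-conicalˡ; ∧-conicalʳ; ∨-conicalˡ; ∨-conicalʳ
        ; not-¬; ¬-not; not-injective)
open import Data.Product using (Σ; ∃-syntax; _×_; _,_; proj₁; proj₂)
open import Data.Sum using (_⊎_; inj₁; inj₂)
open import Function using (_∘_)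
open import Relation.Nullary using (Dec; yes; no; ¬_; contradiction)
open import Relation.Nullary.Decidable using (⌊_⌋; _×-dec_; ¬?)
open import Relation.Binary.PropositionalEquality
  using (_≡_; _≢_; refl; sym; trans; cong; cong₂; subst; subst₂; module ≡-Reasoning)
open import Algebra.Properties.CommutativeMonoid.Sum +-0-commutativeMonoid
  using (sum; sum-syntax; sum-cong-≗; ∑-distrib-+; ∑-comm)
open import Algebra.Properties.CommutativeSemigroup +-commutativeSemigroup using (xy∙z≈xz∙y)

⟦_⟧ : Bool → ℕ
⟦ b ⟧ = if b then 1 else 0

⌊⌋-toWitness : ∀ {p} {P : Set p} (p? : Dec P) → ⌊ p? ⌋ ≡ true → P
⌊⌋-toWitness (yes p) _ = p

⌊⌋-fromWitness : ∀ {p} {P : Set p} (p? : Dec P) → P → ⌊ p? ⌋ ≡ true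
⌊⌋-fromWitness (yes _) _ = refl
⌊⌋-fromWitness (no ¬p) p = contradiction p ¬p

⌊⌋-fromWitnessFalse : ∀ {p} {P : Set p} (p? : Dec P) → ¬ P → ⌊ p? ⌋ ≡ false
⌊⌋-fromWitnessFalse (yes p) ¬p = contradiction p ¬p
⌊⌋-fromWitnessFalse (no _)  _  = refl

⌊⌋-toWitnessFalse : ∀ {p} {P : Set p} (p? : Dec P) → ⌊ p? ⌋ ≡ false → ¬ P
⌊⌋-toWitnessFalse p? ⌊p?⌋≡false p = not-¬ (⌊⌋-fromWitness p? p) ⌊p?⌋≡false

∧-mono : ∀ {a b c} → (a ≡ true → b ≡ true → c ≡ true) → a ∧ b ≡ true → a ∧ c ≡ true
∧-mono {true} b⇒c b = b⇒c refl b

⟦⟧-mono : ∀ {a b} → (a ≡ true → b ≡ true) → ⟦ a ⟧ ≤ ⟦ b ⟧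
⟦⟧-mono {false} _ = z≤n
⟦⟧-mono {true} a⇒b rewrite a⇒b refl = ≤-refl

⟦⟧≤1 : ∀ b → ⟦ b ⟧ ≤ 1
⟦⟧≤1 false = z≤n
⟦⟧≤1 true  = ≤-refl

∑-mono-≤ : ∀ {n} {f g : Fin n → ℕ} → (∀ i → f i ≤ g i) → sum f ≤ sum g
∑-mono-≤ {zero}  f≤g = z≤n
∑-mono-≤ {suc n} f≤g = +-mono-≤ (f≤g Fin.zero) (∑-mono-≤ (f≤g ∘ Fin.suc))

∑-even : ∀ {n} {f : Fin n → ℕ} → (∀ i → Even (f i)) → Even (sum f)
∑-even {zero}  _      = 2 ∣0
∑-even {suc n} f-even = ∣m∣n⇒∣m+n (f-even Fin.zero) (∑-even (f-even ∘ Fin.suc))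

count-sum : ∀ {m} (f : Fin m → Bool) → count f ≡ ∑[ i < m ] ⟦ f i ⟧
count-sum {zero}  f = refl
count-sum {suc m} f = cong (⟦ f Fin.zero ⟧ +_) (count-sum (f ∘ Fin.suc))

count-cong : ∀ {m} {f g : Fin m → Bool} → (∀ i → f i ≡ g i) → count f ≡ count g
count-cong {f = f} {g} f≗g =
  trans (count-sum f) (trans (sum-cong-≗ (cong ⟦_⟧ ∘ f≗g)) (sym (count-sum g)))

count-mono : ∀ {m} {f g : Fin m → Bool} → (∀ i → f i ≡ true → g i ≡ true) → count f ≤ count g
count-mono {f = f} {g} f⊆g = subst₂ _≤_ (sym (count-sum f)) (sym (count-sum g))
  (∑-mono-≤ (⟦⟧-mono ∘ f⊆g))

count≤ : ∀ {m} (f : Fin m → Bool) → count f ≤ m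
count≤ {zero}  f = z≤n
count≤ {suc m} f = +-mono-≤ (⟦⟧≤1 (f Fin.zero)) (count≤ (f ∘ Fin.suc))

count-+ : ∀ {m} (f g : Fin m → Bool) → count f + count g ≡ ∑[ i < m ] (⟦ f i ⟧ + ⟦ g i ⟧)
count-+ f g = trans (cong₂ _+_ (count-sum f) (count-sum g))
  (sym (∑-distrib-+ (⟦_⟧ ∘ f) (⟦_⟧ ∘ g)))

count-partition : ∀ {m} {f g h : Fin m → Bool} → (∀ i → ⟦ f i ⟧ ≡ ⟦ g i ⟧ + ⟦ h i ⟧) →
  count f ≡ count g + count h
count-partition {f = f} {g} {h} split =
  trans (count-sum f) (trans (sum-cong-≗ split) (sym (count-+ g h)))

count-exchange : ∀ {m} {f g h k : Fin m → Bool} → (∀ i → ⟦ f i ⟧ + ⟦ g i ⟧ ≡ ⟦ h i ⟧ + ⟦ k i ⟧) →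
  count f + count g ≡ count h + count k
count-exchange {f = f} {g} {h} {k} exch =
  trans (count-+ f g) (trans (sum-cong-≗ exch) (sym (count-+ h k)))

count-none : ∀ {m} {f : Fin m → Bool} → (∀ i → f i ≡ false) → count f ≡ 0
count-none {zero}  _      = refl
count-none {suc m} {f} none rewrite none Fin.zero = count-none (none ∘ Fin.suc)

count-unique : ∀ {m} {f : Fin m → Bool} (j : Fin m) → (∀ i → f i ≡ true → i ≡ j) →
  count f ≡ ⟦ f j ⟧
count-unique {suc m} {f} Fin.zero only-j =
  trans (cong (⟦ f Fin.zero ⟧ +_) (count-none (λ i → ¬-not (0≢1+n ∘ sym ∘ only-j (Fin.suc i)))))
        (+-identityʳ _)
count-unique {suc m} {f} (Fin.suc j) only-j
  rewrite ¬-not {f Fin.zero} (0≢1+n ∘ only-j Fin.zero) =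
  count-unique j (λ i fi → suc-injective (only-j (Fin.suc i) fi))

module _ {m n : ℕ} (end : Fin m → Fin n) where

  deg : (Fin m → Bool) → Fin n → ℕ
  deg F v = count (λ e → F e ∧ ⌊ end e ≟ v ⌋)

  degOfSet : (Fin m → Bool) → (Fin n → Bool) → ℕ
  degOfSet F S = count (λ e → F e ∧ S (end e))

  degOfSet≡∑deg : ∀ F S → degOfSet F S ≡ ∑[ v < n ] (if S v then deg F v else 0)
  degOfSet≡∑deg F S = begin
    count (λ e → F e ∧ S (end e))                 ≡⟨ count-sum (λ e → F e ∧ S (end e)) ⟩
    ∑[ e < m ] ⟦ F e ∧ S (end e) ⟧                ≡⟨ sum-cong-≗ (sym ∘ pick-end) ⟩
    ∑[ e < m ] count (λ v → incidence e v)        ≡⟨ sum-cong-≗ (λ e → count-sum (incidence e)) ⟩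
    ∑[ e < m ] ∑[ v < n ] ⟦ incidence e v ⟧       ≡⟨ ∑-comm (λ e v → ⟦ incidence e v ⟧) ⟩
    ∑[ v < n ] ∑[ e < m ] ⟦ incidence e v ⟧       ≡⟨ sum-cong-≗ (λ v → sym (count-sum (λ e → incidence e v))) ⟩
    ∑[ v < n ] count (λ e → incidence e v)        ≡⟨ sum-cong-≗ restrict ⟩
    ∑[ v < n ] (if S v then deg F v else 0)       ∎
    where
    open ≡-Reasoning
    incidence : Fin m → Fin n → Bool
    incidence e v = (F e ∧ ⌊ end e ≟ v ⌋) ∧ S v

    pick-end : ∀ e → count (incidence e) ≡ ⟦ F e ∧ S (end e) ⟧
    pick-end e = trans (count-unique (end e) only-end) (cong (λ b → ⟦ b ∧ S (end e) ⟧) F-at-end)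
      where
      only-end : ∀ v → incidence e v ≡ true → v ≡ end e
      only-end v inc = sym (⌊⌋-toWitness (end e ≟ v) (∧-conicalʳ (F e) _ (∧-conicalˡ _ (S v) inc)))
      F-at-end : F e ∧ ⌊ end e ≟ end e ⌋ ≡ F e
      F-at-end = trans (cong (F e ∧_) (⌊⌋-fromWitness (end e ≟ end e) refl)) (∧-identityʳ (F e))

    restrict : ∀ v → count (λ e → incidence e v) ≡ (if S v then deg F v else 0)
    restrict v with S v
    ... | true  = count-cong {m} (λ e → ∧-identityʳ _)
    ... | false = count-none {m} (λ e → ∧-zeroʳ _)

  degOfSet-mono : ∀ {F F′ S} → (∀ v → S v ≡ true → deg F v ≤ deg F′ v) →
    degOfSet F S ≤ degOfSet F′ S
  degOfSet-mono {F} {F′} {S} deg≤ =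
    subst₂ _≤_ (sym (degOfSet≡∑deg F S)) (sym (degOfSet≡∑deg F′ S)) (∑-mono-≤ pointwise)
    where
    pointwise : ∀ v → (if S v then deg F v else 0) ≤ (if S v then deg F′ v else 0)
    pointwise v with S v in Sv
    ... | true  = deg≤ v Sv
    ... | false = z≤n

  degOfSet-even : ∀ {F S} → (∀ v → S v ≡ true → Even (deg F v)) → Even (degOfSet F S)
  degOfSet-even {F} {S} deg-even = subst Even (sym (degOfSet≡∑deg F S)) (∑-even pointwise)
    where
    pointwise : ∀ v → Even (if S v then deg F v else 0)
    pointwise v with S v in Sv
    ... | true  = deg-even v Sv
    ... | false = 2 ∣0

  degOfSet-split : ∀ F {S v} → S v ≡ true →
    degOfSet F S ≡ deg F v + degOfSet F (λ u → S u ∧ not ⌊ u ≟ v ⌋)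
  degOfSet-split F {S} {v} Sv = count-partition pointwise
    where
    pointwise : ∀ e → ⟦ F e ∧ S (end e) ⟧ ≡
      ⟦ F e ∧ ⌊ end e ≟ v ⌋ ⟧ + ⟦ F e ∧ (S (end e) ∧ not ⌊ end e ≟ v ⌋) ⟧
    pointwise e with end e ≟ v | F e
    ... | yes refl | true  rewrite Sv = refl
    ... | yes refl | false = refl
    ... | no _     | true  = cong ⟦_⟧ (sym (∧-identityʳ (S (end e))))
    ... | no _     | false = refl

count-≟ : ∀ {m} (j : Fin m) (P : Fin m → Bool) → count (λ i → ⌊ i ≟ j ⌋ ∧ P i) ≡ ⟦ P j ⟧
count-≟ j P = trans (count-unique j (λ i i=j → ⌊⌋-toWitness (i ≟ j) (∧-conicalˡ _ (P i) i=j)))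
                    (cong (λ b → ⟦ b ∧ P j ⟧) (⌊⌋-fromWitness (j ≟ j) refl))

swap : ∀ {m} → (Fin m → Bool) → Fin m → Fin m → Fin m → Bool
swap C e f i = (C i ∧ not ⌊ i ≟ e ⌋) ∨ ⌊ i ≟ f ⌋

swap-other : ∀ {m} (C : Fin m → Bool) {e f i} → i ≢ e → i ≢ f → swap C e f i ≡ C i
swap-other C {e} {f} {i} i≢e i≢f
  rewrite ⌊⌋-fromWitnessFalse (i ≟ e) i≢e | ⌊⌋-fromWitnessFalse (i ≟ f) i≢f =
  trans (∨-identityʳ _) (∧-identityʳ (C i))

swap-count : ∀ {m} {C : Fin m → Bool} {e f} → C e ≡ true → C f ≡ false → (P : Fin m → Bool) →
  count (λ i → swap C e f i ∧ P i) + ⟦ P e ⟧ ≡ count (λ i → C i ∧ P i) + ⟦ P f ⟧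
swap-count {C = C} {e} {f} Ce Cf P = begin
  after + ⟦ P e ⟧                                ≡⟨ cong (after +_) (count-≟ e P) ⟨
  after + count (λ i → ⌊ i ≟ e ⌋ ∧ P i)          ≡⟨ count-exchange pointwise ⟩
  before + count (λ i → ⌊ i ≟ f ⌋ ∧ P i)         ≡⟨ cong (before +_) (count-≟ f P) ⟩
  before + ⟦ P f ⟧                               ∎
  where
  open ≡-Reasoning
  after before : ℕ
  after  = count (λ i → swap C e f i ∧ P i)
  before = count (λ i → C i ∧ P i)
  pointwise : ∀ i → ⟦ ((C i ∧ not ⌊ i ≟ e ⌋) ∨ ⌊ i ≟ f ⌋) ∧ P i ⟧ + ⟦ ⌊ i ≟ e ⌋ ∧ P i ⟧
                  ≡ ⟦ C i ∧ P i ⟧ + ⟦ ⌊ i ≟ f ⌋ ∧ P i ⟧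
  pointwise i with i ≟ e | i ≟ f
  ... | yes refl | yes refl = contradiction Cf (not-¬ Ce)
  ... | yes refl | no _     rewrite Ce = +-comm 0 ⟦ P i ⟧
  ... | no _     | yes refl rewrite Cf = +-comm ⟦ P i ⟧ 0
  ... | no _     | no _     rewrite ∧-identityʳ (C i) | ∨-identityʳ (C i) = refl

insert : ∀ {n} → Fin n → (Fin n → Bool) → Fin n → Bool
insert v R i = R i ∨ ⌊ i ≟ v ⌋

count-insert : ∀ {n} {v : Fin n} (R : Fin n → Bool) → R v ≡ false →
  count (insert v R) ≡ suc (count R)
count-insert {v = v} R Rv =
  trans (count-partition pointwise) (cong (_+ count R) (count-≟ v (λ _ → true)))
  where
  pointwise : ∀ i → ⟦ R i ∨ ⌊ i ≟ v ⌋ ⟧ ≡ ⟦ ⌊ i ≟ v ⌋ ∧ true ⟧ + ⟦ R i ⟧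
  pointwise i with i ≟ v
  ... | yes refl rewrite Rv = refl
  ... | no _     = cong ⟦_⟧ (∨-identityʳ (R i))

δ : ∀ {n} → Fin n → Fin n → ℕ
δ u v = ⟦ ⌊ u ≟ v ⌋ ⟧

δ-self : ∀ {n} (v : Fin n) → δ v v ≡ 1
δ-self v = cong ⟦_⟧ (⌊⌋-fromWitness (v ≟ v) refl)

δ-distinct : ∀ {n} {u v : Fin n} → u ≢ v → δ u v ≡ 0
δ-distinct {u = u} {v} u≢v = cong ⟦_⟧ (⌊⌋-fromWitnessFalse (u ≟ v) u≢v)

+-transfer : ∀ {a} b {c p q r : ℕ} → a + p ≡ b + q → b + r ≡ c + p → a + r ≡ c + q
+-transfer {a} b {c} {p} {q} {r} h₁ h₂ = +-cancelʳ-≡ p (a + r) (c + q) (begin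
  a + r + p  ≡⟨ xy∙z≈xz∙y a r p ⟩
  a + p + r  ≡⟨ cong (_+ r) h₁ ⟩
  b + q + r  ≡⟨ xy∙z≈xz∙y b q r ⟩
  b + r + q  ≡⟨ cong (_+ q) h₂ ⟩
  c + p + q  ≡⟨ xy∙z≈xz∙y c p q ⟩
  c + q + p  ∎)
  where open ≡-Reasoning

module AlternatingPaths {nx ny m : ℕ} (G : BipMultigraph nx ny m) (A : EdgeSet m) (x₀ : Fin nx) where

  open BipMultigraph G

  -- C is A switched along an alternating path from x₀ to x inside R. The last two fields let the
  -- path be prolonged beyond R: C still contains every A-edge at x, and outside R it agrees with
  -- A, so it contains no B-edge there.
  record Shift (R : Fin nx → Bool) (x : Fin nx) : Set where
    field
      C           : EdgeSet m
      degY-C      : ∀ y → degY G C y ≡ degY G A y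
      degX-C      : ∀ z → degX G C z + δ x₀ z ≡ degX G A z + δ x z
      C≡A-outside : ∀ e → R (xEnd e) ≡ false → C e ≡ A e
      A⊆C-at-end  : ∀ e → xEnd e ≡ x → A e ≡ true → C e ≡ true

  shift-start : ∀ R → Shift R x₀
  shift-start R = record
    { C = A ; degY-C = λ _ → refl ; degX-C = λ _ → refl
    ; C≡A-outside = λ _ _ → refl ; A⊆C-at-end = λ _ _ A-e → A-e }

  shift-mono : ∀ {R R′ x} → (∀ v → R v ≡ true → R′ v ≡ true) → Shift R x → Shift R′ x
  shift-mono R⊆R′ s = record
    { C = C ; degY-C = degY-C ; degX-C = degX-C
    ; C≡A-outside = λ e R′-e → C≡A-outside e (contraposition (R⊆R′ _) R′-e)
    ; A⊆C-at-end = A⊆C-at-end }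
    where
    open Shift s
    contraposition : ∀ {a b} → (a ≡ true → b ≡ true) → b ≡ false → a ≡ false
    contraposition {false} _ _ = refl
    contraposition {true} a⇒b b-false = contradiction b-false (not-¬ (a⇒b refl))

  shift-extend : ∀ {R x} → R x ≡ true → Shift R x → ∀ {e f} →
    A e ≡ true → xEnd e ≡ x → A f ≡ false → yEnd e ≡ yEnd f → R (xEnd f) ≡ false →
    Shift (insert (xEnd f) R) (xEnd f)
  shift-extend {R} {x} R-x s {e} {f} A-e x-e A-f y-e R-f = record
    { C = swap C e f
    ; degY-C = λ y → trans (+-cancelʳ-≡ _ _ _ (swap-degY y)) (degY-C y)
    ; degX-C = λ z → +-transfer (degX G C z) (swap-degX z) (degX-C z)
    ; C≡A-outside = C≡A-outside′
    ; A⊆C-at-end = A⊆C-at-end′ }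
    where
    open Shift s
    C-e : C e ≡ true
    C-e = A⊆C-at-end e x-e A-e
    C-f : C f ≡ false
    C-f = trans (C≡A-outside f R-f) A-f

    swap-degY : ∀ y → degY G (swap C e f) y + δ (yEnd f) y ≡ degY G C y + δ (yEnd f) y
    swap-degY y = subst (λ w → degY G (swap C e f) y + δ w y ≡ degY G C y + δ (yEnd f) y) y-e
      (swap-count {C = C} C-e C-f (λ i → ⌊ yEnd i ≟ y ⌋))

    swap-degX : ∀ z → degX G (swap C e f) z + δ x z ≡ degX G C z + δ (xEnd f) z
    swap-degX z = subst (λ w → degX G (swap C e f) z + δ w z ≡ degX G C z + δ (xEnd f) z) x-e
      (swap-count {C = C} C-e C-f (λ i → ⌊ xEnd i ≟ z ⌋))

    C≡A-outside′ : ∀ i → insert (xEnd f) R (xEnd i) ≡ false → swap C e f i ≡ A i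
    C≡A-outside′ i outside = trans (swap-other C i≢e i≢f) (C≡A-outside i R-i)
      where
      R-i : R (xEnd i) ≡ false
      R-i = ∨-conicalˡ _ _ outside
      i≢e : i ≢ e
      i≢e refl = not-¬ R-x (trans (cong R (sym x-e)) R-i)
      i≢f : i ≢ f
      i≢f refl = not-¬ (⌊⌋-fromWitness (xEnd f ≟ xEnd f) refl) (∨-conicalʳ _ _ outside)

    A⊆C-at-end′ : ∀ i → xEnd i ≡ xEnd f → A i ≡ true → swap C e f i ≡ true
    A⊆C-at-end′ i x-i A-i =
      trans (swap-other C i≢e i≢f) (trans (C≡A-outside i (trans (cong R x-i) R-f)) A-i)
      where
      i≢e : i ≢ e
      i≢e refl = not-¬ R-x (trans (cong R (trans (sym x-e) x-i)) R-f)
      i≢f : i ≢ f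
      i≢f refl = not-¬ A-i A-f

Surplus : ∀ {nx ny m} → BipMultigraph nx ny m → EdgeSet m → ℕ → Fin nx → Set
Surplus G A η x₀ = degX G A x₀ > degX G B x₀
  ⊎ (degX G A x₀ ≡ degX G B x₀ × Odd (degX G A x₀) × Even η × (∀ y → Even (degY G B y)))
  where
  B : EdgeSet _
  B e = not (A e)

module ClosedSets {nx ny m : ℕ} (G : BipMultigraph nx ny m) (A : EdgeSet m) (η : ℕ) (x₀ : Fin nx)
  (B-dominates : (y : Fin ny) → degY G (λ e → not (A e)) y ≥ degY G A y)
  (bounded : (x : Fin nx) → degX G A x ≤ η × degX G (λ e → not (A e)) x ≤ η) where

  open BipMultigraph G

  B : EdgeSet m
  B e = not (A e)

  no-closed-set : ∀ {R RY} → R x₀ ≡ true →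
    (∀ x → R x ≡ true → x ≢ x₀ → η ≤ degX G A x) →
    (∀ e → A e ≡ true → R (xEnd e) ≡ true → RY (yEnd e) ≡ true) →
    (∀ e → B e ≡ true → RY (yEnd e) ≡ true → R (xEnd e) ≡ true) →
    ¬ Surplus G A η x₀
  no-closed-set {R} {RY} R-x₀ saturated A-closed B-closed = refute
    where
    open ≤-Reasoning
    R⁻ : Fin nx → Bool
    R⁻ u = R u ∧ not ⌊ u ≟ x₀ ⌋

    split : ∀ F → degOfSet xEnd F R ≡ degX G F x₀ + degOfSet xEnd F R⁻
    split F = degOfSet-split xEnd F R-x₀

    saturated⁻ : ∀ x → R⁻ x ≡ true → degX G A x ≡ η
    saturated⁻ x R⁻-x = ≤-antisym (proj₁ (bounded x)) (saturated x R-x x≢x₀)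
      where
      R-x : R x ≡ true
      R-x = ∧-conicalˡ _ _ R⁻-x
      x≢x₀ : x ≢ x₀
      x≢x₀ = ⌊⌋-toWitnessFalse (x ≟ x₀) (not-injective (∧-conicalʳ _ _ R⁻-x))

    A-R≤A-RY : degOfSet xEnd A R ≤ degOfSet yEnd A RY
    A-R≤A-RY = count-mono {m} (λ e → ∧-mono (A-closed e))

    A-RY≤B-RY : degOfSet yEnd A RY ≤ degOfSet yEnd B RY
    A-RY≤B-RY = degOfSet-mono yEnd {A} {B} {RY} (λ y _ → B-dominates y)

    B-RY≤B-R : degOfSet yEnd B RY ≤ degOfSet xEnd B R
    B-RY≤B-R = count-mono {m} (λ e → ∧-mono (B-closed e))

    rest-B≤A : degOfSet xEnd B R⁻ ≤ degOfSet xEnd A R⁻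
    rest-B≤A = degOfSet-mono xEnd {B} {A} {R⁻}
      (λ x R⁻-x → ≤-trans (proj₂ (bounded x)) (≤-reflexive (sym (saturated⁻ x R⁻-x))))

    A-x₀≤B-x₀ : degX G A x₀ ≤ degX G B x₀
    A-x₀≤B-x₀ = +-cancelʳ-≤ (degOfSet xEnd A R⁻) _ _ (begin
      degX G A x₀ + degOfSet xEnd A R⁻  ≡⟨ split A ⟨
      degOfSet xEnd A R                 ≤⟨ ≤-trans A-R≤A-RY (≤-trans A-RY≤B-RY B-RY≤B-R) ⟩
      degOfSet xEnd B R                 ≡⟨ split B ⟩
      degX G B x₀ + degOfSet xEnd B R⁻  ≤⟨ +-monoʳ-≤ (degX G B x₀) rest-B≤A ⟩
      degX G B x₀ + degOfSet xEnd A R⁻  ∎)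

    refute : ¬ Surplus G A η x₀
    refute (inj₁ A>B) = <⇒≱ A>B A-x₀≤B-x₀
    refute (inj₂ (A≡B , A-odd , η-even , B-even)) = A-odd (∣m+n∣m⇒∣n A-R-even rest-even)
      where
      B-R≤A-R : degOfSet xEnd B R ≤ degOfSet xEnd A R
      B-R≤A-R = begin
        degOfSet xEnd B R                 ≡⟨ split B ⟩
        degX G B x₀ + degOfSet xEnd B R⁻  ≤⟨ +-mono-≤ (≤-reflexive (sym A≡B)) rest-B≤A ⟩
        degX G A x₀ + degOfSet xEnd A R⁻  ≡⟨ split A ⟨
        degOfSet xEnd A R                 ∎

      A-R≡B-RY : degOfSet xEnd A R ≡ degOfSet yEnd B RY
      A-R≡B-RY = ≤-antisym (≤-trans A-R≤A-RY A-RY≤B-RY) (≤-trans B-RY≤B-R B-R≤A-R)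

      rest-even : Even (degOfSet xEnd A R⁻)
      rest-even = degOfSet-even xEnd {A} {R⁻}
        (λ x R⁻-x → subst Even (sym (saturated⁻ x R⁻-x)) η-even)

      A-R-even : Even (degOfSet xEnd A R⁻ + degX G A x₀)
      A-R-even = subst Even (trans (sym A-R≡B-RY) (trans (split A) (+-comm (degX G A x₀) _)))
        (degOfSet-even yEnd {B} {RY} (λ y _ → B-even y))

module Search {nx ny m : ℕ} (G : BipMultigraph nx ny m) (A : EdgeSet m) (η : ℕ) (x₀ : Fin nx)
  (B-dominates : (y : Fin ny) → degY G (λ e → not (A e)) y ≥ degY G A y)
  (bounded : (x : Fin nx) → degX G A x ≤ η × degX G (λ e → not (A e)) x ≤ η)
  (surplus : Surplus G A η x₀)
  where

  open BipMultigraph G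
  open AlternatingPaths G A x₀
  open ClosedSets G A η x₀ B-dominates bounded

  Conclusion : Set
  Conclusion = Σ (EdgeSet m) λ C →
      ((y : Fin ny) → degY G C y ≡ degY G A y)
      × degX G C x₀ ≡ degX G A x₀ ∸ 1
      × ((x : Fin nx) → x ≢ x₀ → degX G A x ≤ degX G C x × degX G C x ≤ η)

  finish : ∀ {R x} → Shift R x → x ≢ x₀ → degX G A x < η → Conclusion
  finish {x = x} s x≢x₀ A-x<η = C , degY-C , C-x₀ , C-elsewhere
    where
    open Shift s
    C-x₀ : degX G C x₀ ≡ degX G A x₀ ∸ 1
    C-x₀ = begin
      degX G C x₀              ≡⟨ m+n∸n≡m (degX G C x₀) 1 ⟨
      degX G C x₀ + 1 ∸ 1      ≡⟨ cong (_∸ 1) at-x₀ ⟩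
      degX G A x₀ + 0 ∸ 1      ≡⟨ cong (_∸ 1) (+-identityʳ (degX G A x₀)) ⟩
      degX G A x₀ ∸ 1          ∎
      where
      open ≡-Reasoning
      at-x₀ : degX G C x₀ + 1 ≡ degX G A x₀ + 0
      at-x₀ = subst₂ (λ p q → degX G C x₀ + p ≡ degX G A x₀ + q)
                     (δ-self x₀) (δ-distinct x≢x₀) (degX-C x₀)
    C-at : ∀ z → z ≢ x₀ → degX G C z ≡ degX G A z + δ x z
    C-at z z≢x₀ = trans (sym (+-identityʳ _))
      (subst (λ p → degX G C z + p ≡ degX G A z + δ x z) (δ-distinct (z≢x₀ ∘ sym)) (degX-C z))
    C-elsewhere : ∀ z → z ≢ x₀ → degX G A z ≤ degX G C z × degX G C z ≤ η
    C-elsewhere z z≢x₀ with z ≟ x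
    ... | yes refl =
      subst (degX G A x ≤_) (sym C-x) (m≤m+n _ 1) , subst (_≤ η) (trans (+-comm 1 _) (sym C-x)) A-x<η
      where
      C-x : degX G C x ≡ degX G A x + 1
      C-x = trans (C-at x z≢x₀) (cong (degX G A x +_) (δ-self x))
    ... | no z≢x = ≤-reflexive (sym C-z) , subst (_≤ η) (sym C-z) (proj₁ (bounded z))
      where
      C-z : degX G C z ≡ degX G A z
      C-z = trans (C-at z z≢x₀)
        (trans (cong (degX G A z +_) (δ-distinct (z≢x ∘ sym))) (+-identityʳ _))

  Reached : (Fin nx → Bool) → Set
  Reached R = ∀ x → R x ≡ true → Shift R x

  A-neighbour? : (R : Fin nx → Bool) (y : Fin ny) →
    Dec (∃[ e ] (A e ≡ true × R (xEnd e) ≡ true × yEnd e ≡ y))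
  A-neighbour? R y =
    any? (λ e → (A e Bool.≟ true) ×-dec ((R (xEnd e) Bool.≟ true) ×-dec (yEnd e ≟ y)))

  A-neighbourhood : (Fin nx → Bool) → Fin ny → Bool
  A-neighbourhood R y = ⌊ A-neighbour? R y ⌋

  step : ∀ {R} → R x₀ ≡ true → Reached R →
    Conclusion ⊎ ∃[ v ] (R v ≡ false × Reached (insert v R))
  step {R} R-x₀ reached
    with any? (λ x → (R x Bool.≟ true) ×-dec (¬? (x ≟ x₀) ×-dec (degX G A x <? η)))
  ... | yes (x , R-x , x≢x₀ , A-x<η) = inj₁ (finish (reached x R-x) x≢x₀ A-x<η)
  ... | no none-below-η
    with any? (λ f → (B f Bool.≟ true)
                 ×-dec ((A-neighbourhood R (yEnd f) Bool.≟ true) ×-dec (R (xEnd f) Bool.≟ false)))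
  ...   | no closed = contradiction surplus
    (no-closed-set {RY = A-neighbourhood R} R-x₀ saturated A-closed B-closed)
    where
    saturated : ∀ x → R x ≡ true → x ≢ x₀ → η ≤ degX G A x
    saturated x R-x x≢x₀ = ≮⇒≥ (λ A-x<η → none-below-η (x , R-x , x≢x₀ , A-x<η))
    A-closed : ∀ e → A e ≡ true → R (xEnd e) ≡ true → A-neighbourhood R (yEnd e) ≡ true
    A-closed e A-e R-e = ⌊⌋-fromWitness (A-neighbour? R (yEnd e)) (e , A-e , R-e , refl)
    B-closed : ∀ e → B e ≡ true → A-neighbourhood R (yEnd e) ≡ true → R (xEnd e) ≡ true
    B-closed e B-e N-e = ¬-not (λ R-e → closed (e , B-e , N-e , R-e))
  ...   | yes (f , B-f , N-f , R-f) = inj₂ (xEnd f , R-f , reached′)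
    where
    shift-at-xf : Shift (insert (xEnd f) R) (xEnd f)
    shift-at-xf with ⌊⌋-toWitness (A-neighbour? R (yEnd f)) N-f
    ... | e , A-e , R-e , y-e =
      shift-extend R-e (reached (xEnd e) R-e) A-e refl (not-injective B-f) y-e R-f
    reached′ : Reached (insert (xEnd f) R)
    reached′ v ins with R v in R-v
    ... | true  = shift-mono (λ u R-u → cong (_∨ ⌊ u ≟ xEnd f ⌋) R-u) (reached v R-v)
    ... | false = subst (Shift (insert (xEnd f) R)) (sym (⌊⌋-toWitness (v ≟ xEnd f) ins)) shift-at-xf

  grow : ∀ k {R} → nx ≤ count R + k → R x₀ ≡ true → Reached R → Conclusion
  grow k {R} room R-x₀ reached with step R-x₀ reached
  ... | inj₁ done = done
  ... | inj₂ (v , R-v , reached′) with k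
  ...   | zero  = contradiction (subst (nx ≤_) (+-identityʳ _) room)
                    (<⇒≱ (subst (_≤ nx) (count-insert R R-v) (count≤ (insert v R))))
  ...   | suc k = grow k room′ (cong (_∨ ⌊ x₀ ≟ v ⌋) R-x₀) reached′
    where
    room′ : nx ≤ count (insert v R) + k
    room′ = subst (nx ≤_) (trans (+-suc (count R) k) (cong (_+ k) (sym (count-insert R R-v)))) room

lemma3p4 : ∀ {nx ny m : ℕ} (G : BipMultigraph nx ny m)
    (A : EdgeSet m) (η : ℕ) (x₀ : Fin nx) →
    ((y : Fin ny) → degY G (λ e → not (A e)) y ≥ degY G A y) →
    ((x : Fin nx) → degX G A x ≤ η × degX G (λ e → not (A e)) x ≤ η) →
    (degX G A x₀ > degX G (λ e → not (A e)) x₀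
      ⊎ (degX G A x₀ ≡ degX G (λ e → not (A e)) x₀ × Odd (degX G A x₀) × Even η
          × ((y : Fin ny) → Even (degY G (λ e → not (A e)) y)))) →
    Σ (EdgeSet m) λ C →
      ((y : Fin ny) → degY G C y ≡ degY G A y)
      × degX G C x₀ ≡ degX G A x₀ ∸ 1
      × ((x : Fin nx) → x ≢ x₀ → degX G A x ≤ degX G C x × degX G C x ≤ η)
lemma3p4 {nx} G A η x₀ B-dominates bounded surplus =
  grow nx {start} room (⌊⌋-fromWitness (x₀ ≟ x₀) refl) reached
  where
  open AlternatingPaths G A x₀
  open Search G A η x₀ B-dominates bounded surplus

  start : Fin nx → Bool
  start = insert x₀ (λ _ → false)

  room : nx ≤ count start + nx
  room = subst (λ c → nx ≤ c + nx) (sym count-start) (m≤n+m nx 1)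
    where
    count-start : count start ≡ 1
    count-start =
      trans (count-insert {v = x₀} (λ _ → false) refl) (cong suc (count-none {nx} (λ _ → refl)))

  reached : Reached start
  reached x start-x = subst (Shift start) (sym (⌊⌋-toWitness (x ≟ x₀) start-x)) (shift-start start)
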